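{- If $n$ is a positive integer and $r$, $s$ and $j$ are any integers, then \[ 10\sum_{k = 0}^n \binom{2n}{2k}F_{j(2k + r)} F_{j(2k + s)} = \left( L_j^{2n} + 5^n F_j^{2n} \right)L_{j(2n + r + s)} - ( - 1)^{js} 4^{n} L_{j(r - s)}, \] \[ 2\sum_{k = 0}^n \binom{2n}{2k}L_{j(2k + r)} F_{j(2k + s)} = (L_j^{2n} + 5^n F_j^{2n}) F_{j(2n + r + s)} - ( - 1)^{js} 4^{n} F_{j(r - s)}, \] \[ 2\sum_{k = 0}^n \binom{2n}{2k}L_{j(2k + r)} L_{j(2k + s)} = (L_j^{2n} + 5^n F_j^{2n}) L_{j(2n + r + s)} + ( - 1)^{js} 4^{n} L_{j(r - s)}, \] \[ 10\sum_{k = 0}^{n - 1} \binom{2n - 1}{2k} F_{j(2k + r)} F_{j(2k + s)} = ( - 1)^j L_j^{2n - 1} L_{j(2n + r + s - 1)} - ( - 1)^j 5^n F_j^{2n - 1} F_{j(2n + r + s - 1)}- ( - 1)^{js} 2^{2n - 1} L_{j(r - s)}, \] \[ 2\sum_{k = 0}^{n - 1} \binom{2n - 1}{2k}L_{j(2k + r)} F_{j(2k + s)} = ( - 1)^j L_j^{2n - 1} F_{j(2n + r + s - 1)} - ( - 1)^j 5^{n - 1} F_j^{2n - 1} L_{j(2n + r + s - 1)} - ( - 1)^{js} 2^{2n - 1} F_{j(r - s)}, \] \[ 2\sum_{k = 0}^{n - 1} \binom{2n - 1}{2k}L_{j(2k + r)} L_{j(2k + s)} = ( - 1)^j L_j^{2n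 - 1} L_{j(2n + r + s - 1)} - ( - 1)^j 5^n F_j^{2n - 1} F_{j(2n + r + s - 1)} + ( - 1)^{js} 2^{2n - 1} L_{j(r - s)}. \]
   Context: The Fibonacci numbers $F_j$ and Lucas numbers $L_j$ are defined for all integers $j$ by $F_0=0$, $F_1=1$, $L_0=2$, $L_1=1$, $F_j=F_{j-1}+F_{j-2}$, $L_j=L_{j-1}+L_{j-2}$, with $F_{ -j}=(-1)^{j-1}F_j$ and $L_{ -j}=(-1)^jL_j$. -}

module Defs where

open import Data.Nat as ℕ using (ℕ; zero; suc)
open import Data.Nat.Combinatorics using (_C_)
open import Data.Integer as ℤ using (ℤ; +_; -[1+_]; _+_; _*_; -_; _-_)

fibℕ : ℕ → ℤ
fibℕ zero = + 0
fibℕ (suc zero) = + 1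
fibℕ (suc (suc n)) = fibℕ (suc n) + fibℕ n

lucℕ : ℕ → ℤ
lucℕ zero = + 2
lucℕ (suc zero) = + 1
lucℕ (suc (suc n)) = lucℕ (suc n) + lucℕ n

signℕ : ℕ → ℤ
signℕ zero = + 1
signℕ (suc m) = - signℕ m

-- (-1)^m for an integer m (well defined since (-1)^(-m) = (-1)^m)
sgn : ℤ → ℤ
sgn m = signℕ ℤ.∣ m ∣

-- F_j for integer j, with F_{-j} = (-1)^(j-1) F_j
F : ℤ → ℤ
F (+ n) = fibℕ n
F -[1+ n ] = signℕ n * fibℕ (suc n)

-- L_j for integer j, with L_{-j} = (-1)^j L_j
L : ℤ → ℤ
L (+ n) = lucℕ n
L -[1+ n ] = signℕ (suc n) * lucℕ (suc n)

sumTo : ℕ → (ℕ → ℤ) → ℤ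
sumTo zero f = f 0
sumTo (suc n) f = sumTo n f + f (suc n)

binom : ℕ → ℕ → ℤ
binom m k = + (m C k)

-- Write c = L₂ⱼ. For G ∈ {F, L} the sequence uᵢ = G_{j(2i+t)} satisfies uᵢ₊₂ + uᵢ = c uᵢ₊₁, and every
-- solution of this recurrence has Σᵢ C(2n,i) uᵢ = (c + 2)ⁿ uₙ. Since (-1)ⁱ uᵢ solves the recurrence
-- for -c, also Σᵢ (-1)ⁱ C(2n,i) uᵢ = (c - 2)ⁿ uₙ, and adding the two isolates the even-index terms
-- (similarly for 2n + 1). The product formulas 5 F_x F_y = L_{x+y} - (-1)^y L_{x-y} and their
-- relatives make each summand of the theorem such a u₂ₖ plus a constant, and {c + 2, c - 2} is
-- {L_j², 5 F_j²}, in an order fixed by the parity of j. The product formulas come from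
-- 2 F_{x+y} = F_x L_y + L_x F_y and 2 L_{x+y} = L_x L_y + 5 F_x F_y, whose two sides are
-- Fibonacci-like in x and agree at x = 0, 1.

module Submission where

open import Defs
open import Data.Nat as ℕ using (ℕ; zero; suc)
open import Data.Integer using (ℤ; +_; -[1+_]; _+_; _*_; -_; _-_; _^_; ∣_∣)
import Data.Integer.Properties as ℤ
import Data.Nat.Properties as ℕ
open import Data.Integer.Tactic.RingSolver using (solve-∀)
open import Algebra.Properties.CommutativeSemigroup ℤ.+-commutativeSemigroup
  using (interchange; xy∙z≈xz∙y; x∙yz≈xz∙y)
open import Data.Nat.Combinatorics using (k>n⇒nCk≡0; nCk+nC[k+1]≡[n+1]C[k+1])
open import Data.Product using (_×_; _,_; proj₁; proj₂)
open import Data.Sum using (_⊎_; inj₁; inj₂)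
open import Relation.Binary.PropositionalEquality
open ≡-Reasoning

-- Fibonacci-like functions on ℤ

ℤ-induction : (P : ℤ → Set) → P (+ 0) → (∀ z → P z → P (z + + 1)) →
              (∀ z → P (z + + 1) → P z) → ∀ z → P z
ℤ-induction P p₀ up down (+ zero)     = p₀
ℤ-induction P p₀ up down (+ suc n)    =
  subst P (cong +_ (ℕ.+-comm n 1)) (up (+ n) (ℤ-induction P p₀ up down (+ n)))
ℤ-induction P p₀ up down -[1+ zero ]  = down -[1+ 0 ] p₀
ℤ-induction P p₀ up down -[1+ suc n ] = down -[1+ suc n ] (ℤ-induction P p₀ up down -[1+ n ])

record FibonacciLike (f : ℤ → ℤ) : Set where
  constructor fibonacciLike
  field
    recurrence : ∀ x → f (x + + 2) ≡ f (x + + 1) + f x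

open FibonacciLike

module _ {f g : ℤ → ℤ} (fib-f : FibonacciLike f) (fib-g : FibonacciLike g) where

  fibonacciLike-unique : f (+ 0) ≡ g (+ 0) → f (+ 1) ≡ g (+ 1) → ∀ x → f x ≡ g x
  fibonacciLike-unique e₀ e₁ x = proj₁ (ℤ-induction Agree (e₀ , e₁) up down x)
    where
    Agree : ℤ → Set
    Agree z = f z ≡ g z × f (z + + 1) ≡ g (z + + 1)

    twice : ∀ z → z + + 1 + + 1 ≡ z + + 2
    twice z = ℤ.+-assoc z (+ 1) (+ 1)

    unshift : ∀ x y → x ≡ (y + x) - y
    unshift = solve-∀

    up : ∀ z → Agree z → Agree (z + + 1)
    up z (a₀ , a₁) = a₁ , (begin
      f (z + + 1 + + 1)   ≡⟨ cong f (twice z) ⟩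
      f (z + + 2)         ≡⟨ recurrence fib-f z ⟩
      f (z + + 1) + f z   ≡⟨ cong₂ _+_ a₁ a₀ ⟩
      g (z + + 1) + g z   ≡⟨ recurrence fib-g z ⟨
      g (z + + 2)         ≡⟨ cong g (twice z) ⟨
      g (z + + 1 + + 1)   ∎)

    down : ∀ z → Agree (z + + 1) → Agree z
    down z (a₁ , a₂) = (begin
      f z                                ≡⟨ unshift (f z) (f (z + + 1)) ⟩
      (f (z + + 1) + f z) - f (z + + 1)  ≡⟨ cong₂ _-_ (sym (recurrence fib-f z)) a₁ ⟩
      f (z + + 2) - g (z + + 1)          ≡⟨ cong (λ w → f w - g (z + + 1)) (twice z) ⟨
      f (z + + 1 + + 1) - g (z + + 1)    ≡⟨ cong (_- g (z + + 1)) a₂ ⟩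
      g (z + + 1 + + 1) - g (z + + 1)    ≡⟨ cong (λ w → g w - g (z + + 1)) (twice z) ⟩
      g (z + + 2) - g (z + + 1)          ≡⟨ cong (_- g (z + + 1)) (recurrence fib-g z) ⟩
      (g (z + + 1) + g z) - g (z + + 1)  ≡⟨ unshift (g z) (g (z + + 1)) ⟨
      g z                                ∎) , a₁

  fibonacciLike-+ : FibonacciLike (λ x → f x + g x)
  fibonacciLike-+ = fibonacciLike λ x → begin
    f (x + + 2) + g (x + + 2)                     ≡⟨ cong₂ _+_ (recurrence fib-f x) (recurrence fib-g x) ⟩
    (f (x + + 1) + f x) + (g (x + + 1) + g x)     ≡⟨ interchange (f (x + + 1)) (f x) (g (x + + 1)) (g x) ⟩
    (f (x + + 1) + g (x + + 1)) + (f x + g x)     ∎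

fibonacciLike-* : ∀ {f} → FibonacciLike f → ∀ a → FibonacciLike (λ x → a * f x)
fibonacciLike-* fib-f a =
  fibonacciLike λ x → trans (cong (a *_) (recurrence fib-f x)) (ℤ.*-distribˡ-+ a _ _)

fibonacciLike-shift : ∀ {f} → FibonacciLike f → ∀ y → FibonacciLike (λ x → f (x + y))
fibonacciLike-shift {f} fib-f y = fibonacciLike λ x → begin
  f (x + + 2 + y)             ≡⟨ cong f (xy∙z≈xz∙y x (+ 2) y) ⟩
  f (x + y + + 2)             ≡⟨ recurrence fib-f (x + y) ⟩
  f (x + y + + 1) + f (x + y) ≡⟨ cong (λ w → f w + f (x + y)) (xy∙z≈xz∙y x y (+ 1)) ⟩
  f (x + + 1 + y) + f (x + y) ∎

F-fibonacciLike : FibonacciLike F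
F-fibonacciLike = fibonacciLike F-recurrence
  where
  step : ∀ s a b → s * a ≡ - s * b + - - s * (b + a)
  step = solve-∀

  F-recurrence : ∀ x → F (x + + 2) ≡ F (x + + 1) + F x
  F-recurrence (+ n) rewrite ℕ.+-comm n 2 | ℕ.+-comm n 1 = refl
  F-recurrence -[1+ zero ]        = refl
  F-recurrence -[1+ suc zero ]    = refl
  F-recurrence -[1+ suc (suc m) ] = step (signℕ m) (fibℕ (suc m)) (fibℕ (suc (suc m)))

L-fibonacciLike : FibonacciLike L
L-fibonacciLike = fibonacciLike L-recurrence
  where
  step : ∀ s a b → - s * a ≡ - - s * b + - - - s * (b + a)
  step = solve-∀

  L-recurrence : ∀ x → L (x + + 2) ≡ L (x + + 1) + L x
  L-recurrence (+ n) rewrite ℕ.+-comm n 2 | ℕ.+-comm n 1 = refl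
  L-recurrence -[1+ zero ]        = refl
  L-recurrence -[1+ suc zero ]    = refl
  L-recurrence -[1+ suc (suc m) ] = step (signℕ m) (lucℕ (suc m)) (lucℕ (suc (suc m)))

signℕ*signℕ : ∀ n → signℕ n * signℕ n ≡ + 1
signℕ*signℕ zero    = refl
signℕ*signℕ (suc n) = trans (neg*neg (signℕ n)) (signℕ*signℕ n)
  where
  neg*neg : ∀ s → - s * - s ≡ s * s
  neg*neg = solve-∀

sgn*sgn : ∀ z → sgn z * sgn z ≡ + 1
sgn*sgn z = signℕ*signℕ ∣ z ∣

sgn-suc : ∀ z → sgn (z + + 1) ≡ - sgn z
sgn-suc (+ n) rewrite ℕ.+-comm n 1 = refl
sgn-suc -[1+ zero ]  = refl
sgn-suc -[1+ suc n ] = sym (ℤ.neg-involutive (signℕ (suc n)))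

sgn-+ : ∀ x y → sgn (x + y) ≡ sgn x * sgn y
sgn-+ x = ℤ-induction (λ y → sgn (x + y) ≡ sgn x * sgn y) base up down
  where
  base : sgn (x + + 0) ≡ sgn x * + 1
  base = trans (cong sgn (ℤ.+-identityʳ x)) (sym (ℤ.*-identityʳ (sgn x)))

  sgn-suc′ : ∀ y → sgn (x + (y + + 1)) ≡ - sgn (x + y)
  sgn-suc′ y = trans (cong sgn (sym (ℤ.+-assoc x y (+ 1)))) (sgn-suc (x + y))

  up : ∀ y → sgn (x + y) ≡ sgn x * sgn y → sgn (x + (y + + 1)) ≡ sgn x * sgn (y + + 1)
  up y ih = begin
    sgn (x + (y + + 1))  ≡⟨ sgn-suc′ y ⟩
    - sgn (x + y)        ≡⟨ cong -_ ih ⟩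
    - (sgn x * sgn y)    ≡⟨ ℤ.neg-distribʳ-* (sgn x) (sgn y) ⟩
    sgn x * - sgn y      ≡⟨ cong (sgn x *_) (sgn-suc y) ⟨
    sgn x * sgn (y + + 1) ∎

  down : ∀ y → sgn (x + (y + + 1)) ≡ sgn x * sgn (y + + 1) → sgn (x + y) ≡ sgn x * sgn y
  down y ih = begin
    sgn (x + y)              ≡⟨ ℤ.neg-involutive _ ⟨
    - - sgn (x + y)          ≡⟨ cong -_ (sgn-suc′ y) ⟨
    - sgn (x + (y + + 1))    ≡⟨ cong -_ ih ⟩
    - (sgn x * sgn (y + + 1)) ≡⟨ cong (λ s → - (sgn x * s)) (sgn-suc y) ⟩
    - (sgn x * - sgn y)      ≡⟨ cong -_ (ℤ.neg-distribʳ-* (sgn x) (sgn y)) ⟨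
    - - (sgn x * sgn y)      ≡⟨ ℤ.neg-involutive _ ⟩
    sgn x * sgn y            ∎

sgn-double : ∀ z → sgn (z + z) ≡ + 1
sgn-double z = trans (sgn-+ z z) (sgn*sgn z)

signℕ-even : ∀ k → signℕ (2 ℕ.* k) ≡ + 1
signℕ-even k = trans (cong signℕ (cong (k ℕ.+_) (ℕ.+-identityʳ k))) (sgn-double (+ k))

sgn≡±1 : ∀ z → sgn z ≡ + 1 ⊎ sgn z ≡ - + 1
sgn≡±1 z = go ∣ z ∣
  where
  go : ∀ n → signℕ n ≡ + 1 ⊎ signℕ n ≡ - + 1
  go zero = inj₁ refl
  go (suc n) with go n
  ... | inj₁ e = inj₂ (cong -_ e)
  ... | inj₂ e = inj₁ (cong -_ e)

F-neg : ∀ y → F (- y) ≡ - (sgn y * F y)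
F-neg (+ zero)  = refl
F-neg (+ suc n) = flip (signℕ n) (fibℕ (suc n))
  where
  flip : ∀ s a → s * a ≡ - (- s * a)
  flip = solve-∀
F-neg -[1+ n ]  = sym (begin
  - (- signℕ n * (signℕ n * fibℕ (suc n))) ≡⟨ square (signℕ n) (fibℕ (suc n)) ⟩
  signℕ n * signℕ n * fibℕ (suc n)         ≡⟨ cong (_* fibℕ (suc n)) (signℕ*signℕ n) ⟩
  + 1 * fibℕ (suc n)                       ≡⟨ ℤ.*-identityˡ _ ⟩
  fibℕ (suc n)                             ∎)
  where
  square : ∀ s a → - (- s * (s * a)) ≡ s * s * a
  square = solve-∀

L-neg : ∀ y → L (- y) ≡ sgn y * L y
L-neg (+ zero)  = refl
L-neg (+ suc n) = refl
L-neg -[1+ n ]  = sym (begin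
  signℕ (suc n) * (signℕ (suc n) * lucℕ (suc n)) ≡⟨ ℤ.*-assoc (signℕ (suc n)) _ _ ⟨
  signℕ (suc n) * signℕ (suc n) * lucℕ (suc n)   ≡⟨ cong (_* lucℕ (suc n)) (signℕ*signℕ (suc n)) ⟩
  + 1 * lucℕ (suc n)                             ≡⟨ ℤ.*-identityˡ _ ⟩
  lucℕ (suc n)                                   ∎)

-- Addition and product formulas

F-suc : ∀ y → + 2 * F (y + + 1) ≡ L y + F y
F-suc = fibonacciLike-unique
  (fibonacciLike-* (fibonacciLike-shift F-fibonacciLike (+ 1)) (+ 2))
  (fibonacciLike-+ L-fibonacciLike F-fibonacciLike) refl refl

L-suc : ∀ y → + 2 * L (y + + 1) ≡ L y + + 5 * F y
L-suc = fibonacciLike-unique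
  (fibonacciLike-* (fibonacciLike-shift L-fibonacciLike (+ 1)) (+ 2))
  (fibonacciLike-+ L-fibonacciLike (fibonacciLike-* F-fibonacciLike (+ 5))) refl refl

F-+ : ∀ y x → + 2 * F (x + y) ≡ L y * F x + F y * L x
F-+ y = fibonacciLike-unique
  (fibonacciLike-* (fibonacciLike-shift F-fibonacciLike y) (+ 2))
  (fibonacciLike-+ (fibonacciLike-* F-fibonacciLike (L y)) (fibonacciLike-* L-fibonacciLike (F y)))
  at-0 at-1
  where
  at-0 : + 2 * F (+ 0 + y) ≡ L y * + 0 + F y * + 2
  at-0 = trans (cong (λ z → + 2 * F z) (ℤ.+-identityˡ y)) (rearrange (F y) (L y))
    where
    rearrange : ∀ a b → + 2 * a ≡ b * + 0 + a * + 2
    rearrange = solve-∀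

  at-1 : + 2 * F (+ 1 + y) ≡ L y * + 1 + F y * + 1
  at-1 = begin
    + 2 * F (+ 1 + y)       ≡⟨ cong (λ z → + 2 * F z) (ℤ.+-comm (+ 1) y) ⟩
    + 2 * F (y + + 1)       ≡⟨ F-suc y ⟩
    L y + F y               ≡⟨ cong₂ _+_ (ℤ.*-identityʳ (L y)) (ℤ.*-identityʳ (F y)) ⟨
    L y * + 1 + F y * + 1   ∎

L-+ : ∀ y x → + 2 * L (x + y) ≡ L y * L x + + 5 * F y * F x
L-+ y = fibonacciLike-unique
  (fibonacciLike-* (fibonacciLike-shift L-fibonacciLike y) (+ 2))
  (fibonacciLike-+ (fibonacciLike-* L-fibonacciLike (L y)) (fibonacciLike-* F-fibonacciLike (+ 5 * F y)))
  at-0 at-1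
  where
  at-0 : + 2 * L (+ 0 + y) ≡ L y * + 2 + + 5 * F y * + 0
  at-0 = trans (cong (λ z → + 2 * L z) (ℤ.+-identityˡ y)) (rearrange (L y) (F y))
    where
    rearrange : ∀ a b → + 2 * a ≡ a * + 2 + + 5 * b * + 0
    rearrange = solve-∀

  at-1 : + 2 * L (+ 1 + y) ≡ L y * + 1 + + 5 * F y * + 1
  at-1 = begin
    + 2 * L (+ 1 + y)             ≡⟨ cong (λ z → + 2 * L z) (ℤ.+-comm (+ 1) y) ⟩
    + 2 * L (y + + 1)             ≡⟨ L-suc y ⟩
    L y + + 5 * F y               ≡⟨ cong₂ _+_ (ℤ.*-identityʳ (L y)) (ℤ.*-identityʳ (+ 5 * F y)) ⟨
    L y * + 1 + + 5 * F y * + 1   ∎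

involution-cancel : ∀ s a {p q} → s * s ≡ + 1 → a * p ≡ s * q → a * (s * p) ≡ q
involution-cancel s a {p} {q} s*s≡1 e = begin
  a * (s * p)    ≡⟨ swap a s p ⟩
  s * (a * p)    ≡⟨ cong (s *_) e ⟩
  s * (s * q)    ≡⟨ ℤ.*-assoc s s q ⟨
  s * s * q      ≡⟨ cong (_* q) s*s≡1 ⟩
  + 1 * q        ≡⟨ ℤ.*-identityˡ q ⟩
  q              ∎
  where
  swap : ∀ a s p → a * (s * p) ≡ s * (a * p)
  swap = solve-∀

F-− : ∀ y x → + 2 * (sgn y * F (x - y)) ≡ L y * F x - F y * L x
F-− y x = involution-cancel (sgn y) (+ 2) (sgn*sgn y) (begin
  + 2 * F (x - y)                              ≡⟨ F-+ (- y) x ⟩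
  L (- y) * F x + F (- y) * L x                ≡⟨ cong₂ (λ a b → a * F x + b * L x) (L-neg y) (F-neg y) ⟩
  sgn y * L y * F x + - (sgn y * F y) * L x    ≡⟨ factor (sgn y) (L y) (F x) (F y) (L x) ⟩
  sgn y * (L y * F x - F y * L x)              ∎)
  where
  factor : ∀ s a b c d → s * a * b + - (s * c) * d ≡ s * (a * b - c * d)
  factor = solve-∀

L-− : ∀ y x → + 2 * (sgn y * L (x - y)) ≡ L y * L x - + 5 * F y * F x
L-− y x = involution-cancel (sgn y) (+ 2) (sgn*sgn y) (begin
  + 2 * L (x - y)                                    ≡⟨ L-+ (- y) x ⟩
  L (- y) * L x + + 5 * F (- y) * F x                ≡⟨ cong₂ (λ a b → a * L x + + 5 * b * F x) (L-neg y) (F-neg y) ⟩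
  sgn y * L y * L x + + 5 * - (sgn y * F y) * F x    ≡⟨ factor (sgn y) (L y) (L x) (F y) (F x) ⟩
  sgn y * (L y * L x - + 5 * F y * F x)              ∎)
  where
  factor : ∀ s a b c d → s * a * b + + 5 * - (s * c) * d ≡ s * (a * b - + 5 * c * d)
  factor = solve-∀

halves : ∀ {p q} a b → + 2 * p ≡ a + b → + 2 * q ≡ a - b → p + q ≡ a × p - q ≡ b
halves {p} {q} a b e₁ e₂ =
  ℤ.*-cancelˡ-≡ (+ 2) (p + q) a (begin
    + 2 * (p + q)        ≡⟨ ℤ.*-distribˡ-+ (+ 2) p q ⟩
    + 2 * p + + 2 * q    ≡⟨ cong₂ _+_ e₁ e₂ ⟩
    (a + b) + (a - b)    ≡⟨ sum a b ⟩
    + 2 * a              ∎) ,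
  ℤ.*-cancelˡ-≡ (+ 2) (p - q) b (begin
    + 2 * (p - q)        ≡⟨ distrib p q ⟩
    + 2 * p - + 2 * q    ≡⟨ cong₂ _-_ e₁ e₂ ⟩
    (a + b) - (a - b)    ≡⟨ difference a b ⟩
    + 2 * b              ∎)
  where
  sum : ∀ a b → (a + b) + (a - b) ≡ + 2 * a
  sum = solve-∀
  difference : ∀ a b → (a + b) - (a - b) ≡ + 2 * b
  difference = solve-∀
  distrib : ∀ p q → + 2 * (p - q) ≡ + 2 * p - + 2 * q
  distrib = solve-∀

L-sum-product : ∀ y x → L (x + y) + sgn y * L (x - y) ≡ L y * L x
L-sum-product y x = proj₁ (halves (L y * L x) (+ 5 * F y * F x) (L-+ y x) (L-− y x))

L-difference-product : ∀ y x → L (x + y) - sgn y * L (x - y) ≡ + 5 * F y * F x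
L-difference-product y x = proj₂ (halves (L y * L x) (+ 5 * F y * F x) (L-+ y x) (L-− y x))

F-sum-product : ∀ y x → F (x + y) + sgn y * F (x - y) ≡ L y * F x
F-sum-product y x = proj₁ (halves (L y * F x) (F y * L x) (F-+ y x) (F-− y x))

F-difference-product : ∀ y x → F (x + y) - sgn y * F (x - y) ≡ F y * L x
F-difference-product y x = proj₂ (halves (L y * F x) (F y * L x) (F-+ y x) (F-− y x))

-- Binomial sums of solutions of u (i + 2) + u i = c * u (i + 1)

sumTo-cong : ∀ m {f g : ℕ → ℤ} → (∀ k → f k ≡ g k) → sumTo m f ≡ sumTo m g
sumTo-cong zero    f≗g = f≗g 0
sumTo-cong (suc m) f≗g = cong₂ _+_ (sumTo-cong m f≗g) (f≗g (suc m))

sumTo-+ : ∀ m (f g : ℕ → ℤ) → sumTo m (λ k → f k + g k) ≡ sumTo m f + sumTo m g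
sumTo-+ zero    f g = refl
sumTo-+ (suc m) f g = trans (cong (_+ (f (suc m) + g (suc m))) (sumTo-+ m f g))
  (interchange (sumTo m f) (sumTo m g) (f (suc m)) (g (suc m)))

*-sumTo : ∀ a m (f : ℕ → ℤ) → a * sumTo m f ≡ sumTo m (λ k → a * f k)
*-sumTo a zero    f = refl
*-sumTo a (suc m) f = trans (ℤ.*-distribˡ-+ a (sumTo m f) (f (suc m)))
  (cong (_+ a * f (suc m)) (*-sumTo a m f))

sumTo-suc-head : ∀ m (f : ℕ → ℤ) → sumTo (suc m) f ≡ f 0 + sumTo m (λ k → f (suc k))
sumTo-suc-head zero    f = refl
sumTo-suc-head (suc m) f = trans (cong (_+ f (suc (suc m))) (sumTo-suc-head m f))
  (ℤ.+-assoc (f 0) _ _)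

sumTo-pairs : ∀ m (h : ℕ → ℤ) →
  sumTo (suc (2 ℕ.* m)) h ≡ sumTo m (λ k → h (2 ℕ.* k) + h (suc (2 ℕ.* k)))
sumTo-pairs zero    h = refl
sumTo-pairs (suc m) h = begin
  sumTo (suc (2 ℕ.* suc m)) h                       ≡⟨ cong (λ N → sumTo (suc N) h) (ℕ.*-suc 2 m) ⟩
  sumTo (suc (2 ℕ.* m)) h + h (2 ℕ.+ 2 ℕ.* m) + h (3 ℕ.+ 2 ℕ.* m)
                                                    ≡⟨ ℤ.+-assoc (sumTo (suc (2 ℕ.* m)) h) _ _ ⟩
  sumTo (suc (2 ℕ.* m)) h + (h (2 ℕ.+ 2 ℕ.* m) + h (3 ℕ.+ 2 ℕ.* m))
                                                    ≡⟨ cong₂ _+_ (sumTo-pairs m h) (cong (λ N → h N + h (suc N)) (sym (ℕ.*-suc 2 m))) ⟩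
  sumTo (suc m) (λ k → h (2 ℕ.* k) + h (suc (2 ℕ.* k))) ∎

binomialSum : ℕ → (ℕ → ℤ) → ℤ
binomialSum N u = sumTo N (λ i → binom N i * u i)

shift : (ℕ → ℤ) → ℕ → ℤ
shift u i = u (suc i)

binomialSum-extend : ∀ N u → sumTo (suc N) (λ i → binom N i * u i) ≡ binomialSum N u
binomialSum-extend N u rewrite k>n⇒nCk≡0 (ℕ.n<1+n N) = ℤ.+-identityʳ (binomialSum N u)

binomialSum-suc : ∀ N u → binomialSum (suc N) u ≡ binomialSum N u + binomialSum N (shift u)
binomialSum-suc N u = begin
  binomialSum (suc N) u
    ≡⟨ sumTo-suc-head N _ ⟩
  u₀ + sumTo N (λ i → binom (suc N) (suc i) * u (suc i))
    ≡⟨ cong (_+_ u₀) (sumTo-cong N pascal) ⟩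
  u₀ + sumTo N (λ i → binom N i * u (suc i) + binom N (suc i) * u (suc i))
    ≡⟨ cong (_+_ u₀) (sumTo-+ N _ _) ⟩
  u₀ + (binomialSum N (shift u) + sumTo N (λ i → binom N (suc i) * u (suc i)))
    ≡⟨ x∙yz≈xz∙y u₀ _ _ ⟩
  (u₀ + sumTo N (λ i → binom N (suc i) * u (suc i))) + binomialSum N (shift u)
    ≡⟨ cong (_+ binomialSum N (shift u)) (sumTo-suc-head N _) ⟨
  sumTo (suc N) (λ i → binom N i * u i) + binomialSum N (shift u)
    ≡⟨ cong (_+ binomialSum N (shift u)) (binomialSum-extend N u) ⟩
  binomialSum N u + binomialSum N (shift u)
    ∎
  where
  u₀ = + 1 * u 0
  pascal : ∀ i → binom (suc N) (suc i) * u (suc i) ≡ binom N i * u (suc i) + binom N (suc i) * u (suc i)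
  pascal i = trans (cong (λ b → + b * u (suc i)) (sym (nCk+nC[k+1]≡[n+1]C[k+1] N i)))
                   (ℤ.*-distribʳ-+ (u (suc i)) (binom N i) (binom N (suc i)))

record Recurrence (c : ℤ) (u : ℕ → ℤ) : Set where
  constructor mkRecurrence
  field
    recur : ∀ i → u (suc (suc i)) + u i ≡ c * u (suc i)

open Recurrence

shift-recurrence : ∀ {c u} → Recurrence c u → Recurrence c (shift u)
shift-recurrence rec = mkRecurrence λ i → recur rec (suc i)

-- For u i = λⁱ with λ + λ⁻¹ = c this is (1 + λ)²ⁿ = λⁿ (c + 2)ⁿ.
binomialSum-even : ∀ {c u} → Recurrence c u → ∀ n → binomialSum (2 ℕ.* n) u ≡ (c + + 2) ^ n * u n
binomialSum-even rec zero = refl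
binomialSum-even {c} {u} rec (suc n) = begin
  binomialSum (2 ℕ.* suc n) u
    ≡⟨ cong (λ N → binomialSum N u) (ℕ.*-suc 2 n) ⟩
  binomialSum (suc (suc N)) u
    ≡⟨ binomialSum-suc (suc N) u ⟩
  binomialSum (suc N) u + binomialSum (suc N) (shift u)
    ≡⟨ cong₂ _+_ (binomialSum-suc N u) (binomialSum-suc N (shift u)) ⟩
  (binomialSum N u + binomialSum N (shift u)) + (binomialSum N (shift u) + binomialSum N (shift (shift u)))
    ≡⟨ cong₂ _+_ (cong₂ _+_ ih₀ ih₁) (cong₂ _+_ ih₁ ih₂) ⟩
  (P * u n + P * u (suc n)) + (P * u (suc n) + P * u (suc (suc n)))
    ≡⟨ collect P (u n) (u (suc n)) (u (suc (suc n))) ⟩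
  P * (u (suc (suc n)) + u n + + 2 * u (suc n))
    ≡⟨ cong (λ v → P * (v + + 2 * u (suc n))) (recur rec n) ⟩
  P * (c * u (suc n) + + 2 * u (suc n))
    ≡⟨ factor P c (u (suc n)) ⟩
  (c + + 2) * P * u (suc n)
    ∎
  where
  N = 2 ℕ.* n
  P = (c + + 2) ^ n
  ih₀ = binomialSum-even rec n
  ih₁ = binomialSum-even (shift-recurrence rec) n
  ih₂ = binomialSum-even (shift-recurrence (shift-recurrence rec)) n
  collect : ∀ p a b c → (p * a + p * b) + (p * b + p * c) ≡ p * (c + a + + 2 * b)
  collect = solve-∀
  factor : ∀ p c a → p * (c * a + + 2 * a) ≡ (c + + 2) * p * a
  factor = solve-∀

binomialSum-odd : ∀ {c u} → Recurrence c u → ∀ n →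
  binomialSum (suc (2 ℕ.* n)) u ≡ (c + + 2) ^ n * (u n + u (suc n))
binomialSum-odd {c} {u} rec n = begin
  binomialSum (suc (2 ℕ.* n)) u                                  ≡⟨ binomialSum-suc (2 ℕ.* n) u ⟩
  binomialSum (2 ℕ.* n) u + binomialSum (2 ℕ.* n) (shift u)      ≡⟨ cong₂ _+_ (binomialSum-even rec n)
                                                                         (binomialSum-even (shift-recurrence rec) n) ⟩
  (c + + 2) ^ n * u n + (c + + 2) ^ n * u (suc n)                ≡⟨ ℤ.*-distribˡ-+ ((c + + 2) ^ n) (u n) (u (suc n)) ⟨
  (c + + 2) ^ n * (u n + u (suc n))                              ∎

alternating : (ℕ → ℤ) → ℕ → ℤ
alternating u i = signℕ i * u i

alternating-recurrence : ∀ {c u} → Recurrence c u → Recurrence (- c) (alternating u)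
alternating-recurrence {c} {u} rec = mkRecurrence λ i → begin
  - - signℕ i * u (suc (suc i)) + signℕ i * u i  ≡⟨ factor (signℕ i) (u (suc (suc i))) (u i) ⟩
  signℕ i * (u (suc (suc i)) + u i)              ≡⟨ cong (signℕ i *_) (recur rec i) ⟩
  signℕ i * (c * u (suc i))                      ≡⟨ regroup (signℕ i) c (u (suc i)) ⟩
  - c * (- signℕ i * u (suc i))                  ∎
  where
  factor : ∀ s a b → - - s * a + s * b ≡ s * (a + b)
  factor = solve-∀
  regroup : ∀ s c a → s * (c * a) ≡ - c * (- s * a)
  regroup = solve-∀

neg-^ : ∀ x n → (- x) ^ n ≡ signℕ n * x ^ n
neg-^ x zero    = refl
neg-^ x (suc n) = trans (cong (- x *_) (neg-^ x n)) (regroup x (signℕ n) (x ^ n))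
  where
  regroup : ∀ x s p → - x * (s * p) ≡ - s * (x * p)
  regroup = solve-∀

alternating-power : ∀ c n a → (- c + + 2) ^ n * (signℕ n * a) ≡ (c - + 2) ^ n * a
alternating-power c n a = begin
  (- c + + 2) ^ n * (signℕ n * a)              ≡⟨ cong (λ x → x ^ n * (signℕ n * a)) (negate c) ⟩
  (- (c - + 2)) ^ n * (signℕ n * a)            ≡⟨ cong (_* (signℕ n * a)) (neg-^ (c - + 2) n) ⟩
  signℕ n * (c - + 2) ^ n * (signℕ n * a)      ≡⟨ regroup (signℕ n) ((c - + 2) ^ n) a ⟩
  signℕ n * signℕ n * ((c - + 2) ^ n * a)      ≡⟨ cong (_* ((c - + 2) ^ n * a)) (signℕ*signℕ n) ⟩
  + 1 * ((c - + 2) ^ n * a)                    ≡⟨ ℤ.*-identityˡ _ ⟩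
  (c - + 2) ^ n * a                            ∎
  where
  negate : ∀ c → - c + + 2 ≡ - (c - + 2)
  negate = solve-∀
  regroup : ∀ s p a → s * p * (s * a) ≡ s * s * (p * a)
  regroup = solve-∀

binomialSum-even-alternating : ∀ {c u} → Recurrence c u → ∀ n →
  binomialSum (2 ℕ.* n) (alternating u) ≡ (c - + 2) ^ n * u n
binomialSum-even-alternating {c} {u} rec n =
  trans (binomialSum-even (alternating-recurrence rec) n) (alternating-power c n (u n))

binomialSum-odd-alternating : ∀ {c u} → Recurrence c u → ∀ n →
  binomialSum (suc (2 ℕ.* n)) (alternating u) ≡ (c - + 2) ^ n * (u n - u (suc n))
binomialSum-odd-alternating {c} {u} rec n = begin
  binomialSum (suc (2 ℕ.* n)) (alternating u)
    ≡⟨ binomialSum-odd (alternating-recurrence rec) n ⟩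
  (- c + + 2) ^ n * (signℕ n * u n + - signℕ n * u (suc n))
    ≡⟨ cong ((- c + + 2) ^ n *_) (factor (signℕ n) (u n) (u (suc n))) ⟩
  (- c + + 2) ^ n * (signℕ n * (u n - u (suc n)))
    ≡⟨ alternating-power c n (u n - u (suc n)) ⟩
  (c - + 2) ^ n * (u n - u (suc n))
    ∎
  where
  factor : ∀ s a b → s * a + - s * b ≡ s * (a - b)
  factor = solve-∀

evenBinomialSum : ℕ → ℕ → (ℕ → ℤ) → ℤ
evenBinomialSum N m f = sumTo m (λ k → binom N (2 ℕ.* k) * f k)

evenBinomialSum-affine : ∀ N m a b (f g : ℕ → ℤ) → (∀ k → a * f k ≡ g k + b) →
  a * evenBinomialSum N m f ≡ evenBinomialSum N m g + b * evenBinomialSum N m (λ _ → + 1)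
evenBinomialSum-affine N m a b f g a*f≡g+b = begin
  a * evenBinomialSum N m f
    ≡⟨ *-sumTo a m _ ⟩
  sumTo m (λ k → a * (C k * f k))
    ≡⟨ sumTo-cong m termwise ⟩
  sumTo m (λ k → C k * g k + b * (C k * + 1))
    ≡⟨ sumTo-+ m _ _ ⟩
  evenBinomialSum N m g + sumTo m (λ k → b * (C k * + 1))
    ≡⟨ cong (_+_ (evenBinomialSum N m g)) (*-sumTo b m _) ⟨
  evenBinomialSum N m g + b * evenBinomialSum N m (λ _ → + 1)
    ∎
  where
  C : ℕ → ℤ
  C k = binom N (2 ℕ.* k)
  distribute : ∀ a c f g b → a * f ≡ g + b → a * (c * f) ≡ c * g + b * (c * + 1)
  distribute a c f g b e = trans (swap a c f) (trans (cong (c *_) e) (expand c g b))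
    where
    swap : ∀ a c f → a * (c * f) ≡ c * (a * f)
    swap = solve-∀
    expand : ∀ c g b → c * (g + b) ≡ c * g + b * (c * + 1)
    expand = solve-∀
  termwise : ∀ k → a * (C k * f k) ≡ C k * g k + b * (C k * + 1)
  termwise k = distribute a (C k) (f k) (g k) b (a*f≡g+b k)

double-evenBinomialSum : ∀ N m u → + 2 * evenBinomialSum N m (λ k → u (2 ℕ.* k)) ≡
  sumTo (suc (2 ℕ.* m)) (λ i → binom N i * u i) + sumTo (suc (2 ℕ.* m)) (λ i → binom N i * alternating u i)
double-evenBinomialSum N m u = begin
  + 2 * evenBinomialSum N m (λ k → u (2 ℕ.* k))
    ≡⟨ *-sumTo (+ 2) m _ ⟩
  sumTo m (λ k → + 2 * (binom N (2 ℕ.* k) * u (2 ℕ.* k)))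
    ≡⟨ sumTo-cong m pair ⟨
  sumTo m (λ k → h (2 ℕ.* k) + h (suc (2 ℕ.* k)))
    ≡⟨ sumTo-pairs m h ⟨
  sumTo (suc (2 ℕ.* m)) h
    ≡⟨ sumTo-+ (suc (2 ℕ.* m)) _ _ ⟩
  sumTo (suc (2 ℕ.* m)) (λ i → binom N i * u i) + sumTo (suc (2 ℕ.* m)) (λ i → binom N i * alternating u i)
    ∎
  where
  h : ℕ → ℤ
  h i = binom N i * u i + binom N i * alternating u i
  cancel : ∀ a b a′ b′ → (a * b + a * (+ 1 * b)) + (a′ * b′ + a′ * (- + 1 * b′)) ≡ + 2 * (a * b)
  cancel = solve-∀
  pair : ∀ k → h (2 ℕ.* k) + h (suc (2 ℕ.* k)) ≡ + 2 * (binom N (2 ℕ.* k) * u (2 ℕ.* k))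
  pair k rewrite signℕ-even k =
    cancel (binom N (2 ℕ.* k)) (u (2 ℕ.* k)) (binom N (suc (2 ℕ.* k))) (u (suc (2 ℕ.* k)))

evenBinomialSum-even : ∀ {c u} → Recurrence c u → ∀ n →
  + 2 * evenBinomialSum (2 ℕ.* n) n (λ k → u (2 ℕ.* k)) ≡ ((c + + 2) ^ n + (c - + 2) ^ n) * u n
evenBinomialSum-even {c} {u} rec n = begin
  + 2 * evenBinomialSum (2 ℕ.* n) n (λ k → u (2 ℕ.* k))
    ≡⟨ double-evenBinomialSum (2 ℕ.* n) n u ⟩
  sumTo (suc (2 ℕ.* n)) (λ i → binom (2 ℕ.* n) i * u i)
    + sumTo (suc (2 ℕ.* n)) (λ i → binom (2 ℕ.* n) i * alternating u i)
    ≡⟨ cong₂ _+_ (binomialSum-extend (2 ℕ.* n) u) (binomialSum-extend (2 ℕ.* n) (alternating u)) ⟩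
  binomialSum (2 ℕ.* n) u + binomialSum (2 ℕ.* n) (alternating u)
    ≡⟨ cong₂ _+_ (binomialSum-even rec n) (binomialSum-even-alternating rec n) ⟩
  (c + + 2) ^ n * u n + (c - + 2) ^ n * u n
    ≡⟨ ℤ.*-distribʳ-+ (u n) ((c + + 2) ^ n) ((c - + 2) ^ n) ⟨
  ((c + + 2) ^ n + (c - + 2) ^ n) * u n
    ∎

evenBinomialSum-odd : ∀ {c u} → Recurrence c u → ∀ n →
  + 2 * evenBinomialSum (suc (2 ℕ.* n)) n (λ k → u (2 ℕ.* k))
    ≡ (c + + 2) ^ n * (u n + u (suc n)) + (c - + 2) ^ n * (u n - u (suc n))
evenBinomialSum-odd rec n =
  trans (double-evenBinomialSum (suc (2 ℕ.* n)) n _)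
        (cong₂ _+_ (binomialSum-odd rec n) (binomialSum-odd-alternating rec n))

^-double : ∀ x n → x ^ (2 ℕ.* n) ≡ (x * x) ^ n
^-double x n = trans (sym (ℤ.^-*-assoc x 2 n)) (cong (λ y → (x * y) ^ n) (ℤ.*-identityʳ x))

^-distribʳ-* : ∀ x y n → (x * y) ^ n ≡ x ^ n * y ^ n
^-distribʳ-* x y zero    = refl
^-distribʳ-* x y (suc n) = trans (cong (x * y *_) (^-distribʳ-* x y n)) (interchange* x y (x ^ n) (y ^ n))
  where
  interchange* : ∀ a b c d → a * b * (c * d) ≡ a * c * (b * d)
  interchange* = solve-∀

evenBinomialSum-ones-even : ∀ n → + 2 * evenBinomialSum (2 ℕ.* suc n) (suc n) (λ _ → + 1) ≡ (+ 4) ^ suc n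
evenBinomialSum-ones-even n =
  trans (evenBinomialSum-even {c = + 2} {u = λ _ → + 1} (mkRecurrence λ _ → refl) (suc n)) (simplify ((+ 4) ^ suc n))
  where
  simplify : ∀ x → (x + + 0) * + 1 ≡ x
  simplify = solve-∀

evenBinomialSum-ones-odd : ∀ n → + 2 * evenBinomialSum (suc (2 ℕ.* n)) n (λ _ → + 1) ≡ (+ 2) ^ suc (2 ℕ.* n)
evenBinomialSum-ones-odd n = begin
  + 2 * evenBinomialSum (suc (2 ℕ.* n)) n (λ _ → + 1)
    ≡⟨ evenBinomialSum-odd {c = + 2} {u = λ _ → + 1} (mkRecurrence λ _ → refl) n ⟩
  (+ 4) ^ n * (+ 1 + + 1) + (+ 0) ^ n * (+ 1 - + 1)
    ≡⟨ simplify ((+ 4) ^ n) ((+ 0) ^ n) ⟩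
  + 2 * (+ 4) ^ n
    ≡⟨ cong (+ 2 *_) (^-double (+ 2) n) ⟨
  (+ 2) ^ suc (2 ℕ.* n)
    ∎
  where
  simplify : ∀ x z → x * (+ 1 + + 1) + z * (+ 1 - + 1) ≡ + 2 * x
  simplify = solve-∀

L-square : ∀ j → L j * L j ≡ L (j + j) + + 2 * sgn j
L-square j = begin
  L j * L j                        ≡⟨ L-sum-product j j ⟨
  L (j + j) + sgn j * L (j - j)    ≡⟨ cong (λ z → L (j + j) + sgn j * L z) (ℤ.+-inverseʳ j) ⟩
  L (j + j) + sgn j * + 2          ≡⟨ cong (_+_ (L (j + j))) (ℤ.*-comm (sgn j) (+ 2)) ⟩
  L (j + j) + + 2 * sgn j          ∎

F-square : ∀ j → + 5 * F j * F j ≡ L (j + j) - + 2 * sgn j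
F-square j = begin
  + 5 * F j * F j                  ≡⟨ L-difference-product j j ⟨
  L (j + j) - sgn j * L (j - j)    ≡⟨ cong (λ z → L (j + j) - sgn j * L z) (ℤ.+-inverseʳ j) ⟩
  L (j + j) - sgn j * + 2          ≡⟨ cong (λ z → L (j + j) - z) (ℤ.*-comm (sgn j) (+ 2)) ⟩
  L (j + j) - + 2 * sgn j          ∎

L-power : ∀ j n → L j ^ (2 ℕ.* n) ≡ (L (j + j) + + 2 * sgn j) ^ n
L-power j n = trans (^-double (L j) n) (cong (_^ n) (L-square j))

F-power : ∀ j n → (+ 5) ^ n * F j ^ (2 ℕ.* n) ≡ (L (j + j) - + 2 * sgn j) ^ n
F-power j n = begin
  (+ 5) ^ n * F j ^ (2 ℕ.* n)      ≡⟨ cong ((+ 5) ^ n *_) (^-double (F j) n) ⟩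
  (+ 5) ^ n * (F j * F j) ^ n      ≡⟨ ^-distribʳ-* (+ 5) (F j * F j) n ⟨
  (+ 5 * (F j * F j)) ^ n          ≡⟨ cong (_^ n) (ℤ.*-assoc (+ 5) (F j) (F j)) ⟨
  (+ 5 * F j * F j) ^ n            ≡⟨ cong (_^ n) (F-square j) ⟩
  (L (j + j) - + 2 * sgn j) ^ n    ∎

-- Depending on the parity of j, the pair (L₂ⱼ + 2, L₂ⱼ - 2) is (L_j², 5F_j²) or (5F_j², L_j²).
even-powers : ∀ j n →
  (L (j + j) + + 2) ^ n + (L (j + j) - + 2) ^ n ≡ L j ^ (2 ℕ.* n) + (+ 5) ^ n * F j ^ (2 ℕ.* n)
even-powers j n = trans (swap (sgn≡±1 j)) (sym (cong₂ _+_ (L-power j n) (F-power j n)))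
  where
  c = L (j + j)
  swap : ∀ {ε} → ε ≡ + 1 ⊎ ε ≡ - + 1 → (c + + 2) ^ n + (c - + 2) ^ n ≡ (c + + 2 * ε) ^ n + (c - + 2 * ε) ^ n
  swap (inj₁ refl) = refl
  swap (inj₂ refl) = ℤ.+-comm ((c + + 2) ^ n) ((c - + 2) ^ n)

odd-powers : ∀ j n a b →
  (L (j + j) + + 2) ^ n * (a + b) + (L (j + j) - + 2) ^ n * (a - b)
    ≡ sgn j * (L j ^ (2 ℕ.* n) * (b + sgn j * a)) - sgn j * ((+ 5) ^ n * F j ^ (2 ℕ.* n) * (b - sgn j * a))
odd-powers j n a b rewrite L-power j n | F-power j n = swap (sgn≡±1 j)
  where
  c = L (j + j)
  case+1 : ∀ p m a b → p * (a + b) + m * (a - b) ≡ + 1 * (p * (b + + 1 * a)) - + 1 * (m * (b - + 1 * a))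
  case+1 = solve-∀
  case-1 : ∀ p m a b → p * (a + b) + m * (a - b) ≡ - + 1 * (m * (b + - + 1 * a)) - - + 1 * (p * (b - - + 1 * a))
  case-1 = solve-∀
  swap : ∀ {ε} → ε ≡ + 1 ⊎ ε ≡ - + 1 →
    (c + + 2) ^ n * (a + b) + (c - + 2) ^ n * (a - b)
      ≡ ε * ((c + + 2 * ε) ^ n * (b + ε * a)) - ε * ((c - + 2 * ε) ^ n * (b - ε * a))
  swap (inj₁ refl) = case+1 ((c + + 2) ^ n) ((c - + 2) ^ n) a b
  swap (inj₂ refl) = case-1 ((c + + 2) ^ n) ((c - + 2) ^ n) a b

-- The sums of the theorem

subsequence : (ℤ → ℤ) → ℤ → ℤ → ℕ → ℤ
subsequence G j t i = G (j * (+ (2 ℕ.* i) + t))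

+[2*suc] : ∀ n → + (2 ℕ.* suc n) ≡ + (2 ℕ.* n) + + 2
+[2*suc] n = cong +_ (trans (ℕ.*-suc 2 n) (ℕ.+-comm 2 (2 ℕ.* n)))

subsequence-recurrence : ∀ {G : ℤ → ℤ} → (∀ y x → G (x + y) + sgn y * G (x - y) ≡ L y * G x) →
  ∀ j t → Recurrence (L (j + j)) (subsequence G j t)
subsequence-recurrence {G} G-sum-product j t = mkRecurrence λ i → begin
  G (j * (+ (2 ℕ.* suc (suc i)) + t)) + G (j * (+ (2 ℕ.* i) + t))
    ≡⟨ cong₂ (λ a b → G a + G b) (ahead i) (behind i) ⟩
  G (x i + (j + j)) + G (x i - (j + j))
    ≡⟨ cong (_+_ (G (x i + (j + j)))) (ℤ.*-identityˡ _) ⟨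
  G (x i + (j + j)) + + 1 * G (x i - (j + j))
    ≡⟨ cong (λ s → G (x i + (j + j)) + s * G (x i - (j + j))) (sgn-double j) ⟨
  G (x i + (j + j)) + sgn (j + j) * G (x i - (j + j))
    ≡⟨ G-sum-product (j + j) (x i) ⟩
  L (j + j) * G (x i)
    ∎
  where
  x : ℕ → ℤ
  x i = j * (+ (2 ℕ.* suc i) + t)
  step₊ : ∀ j a t → j * (a + + 2 + t) ≡ j * (a + t) + (j + j)
  step₊ = solve-∀
  step₋ : ∀ j a t → j * (a + t) ≡ j * (a + + 2 + t) - (j + j)
  step₋ = solve-∀
  ahead : ∀ i → j * (+ (2 ℕ.* suc (suc i)) + t) ≡ x i + (j + j)
  ahead i = trans (cong (λ z → j * (z + t)) (+[2*suc] (suc i))) (step₊ j (+ (2 ℕ.* suc i)) t)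
  behind : ∀ i → j * (+ (2 ℕ.* i) + t) ≡ x i - (j + j)
  behind i = trans (step₋ j (+ (2 ℕ.* i)) t) (cong (λ z → j * (z + t) - (j + j)) (sym (+[2*suc] i)))

doubled-affine : ∀ N m a b (f u : ℕ → ℤ) → (∀ k → a * f k ≡ u (2 ℕ.* k) + b) →
  + 2 * (a * evenBinomialSum N m f)
    ≡ + 2 * evenBinomialSum N m (λ k → u (2 ℕ.* k)) + b * (+ 2 * evenBinomialSum N m (λ _ → + 1))
doubled-affine N m a b f u a*f≡u+b =
  trans (cong (+ 2 *_) (evenBinomialSum-affine N m a b f (λ k → u (2 ℕ.* k)) a*f≡u+b))
        (distribute (evenBinomialSum N m (λ k → u (2 ℕ.* k))) b (evenBinomialSum N m (λ _ → + 1)))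
  where
  distribute : ∀ x b y → + 2 * (x + b * y) ≡ + 2 * x + b * (+ 2 * y)
  distribute = solve-∀

evenBinomialSum-subsequence-even : ∀ {G : ℤ → ℤ} → (∀ y x → G (x + y) + sgn y * G (x - y) ≡ L y * G x) →
  ∀ j r s n a b (f : ℕ → ℤ) → (∀ k → a * f k ≡ subsequence G j (r + s) (2 ℕ.* k) + b) →
  + 2 * (a * evenBinomialSum (2 ℕ.* suc n) (suc n) f)
    ≡ (L j ^ (2 ℕ.* suc n) + (+ 5) ^ suc n * F j ^ (2 ℕ.* suc n)) * G (j * (+ (2 ℕ.* suc n) + r + s))
      + b * (+ 4) ^ suc n
evenBinomialSum-subsequence-even {G} G-sum-product j r s n a b f a*f≡u+b = begin
  + 2 * (a * evenBinomialSum N (suc n) f)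
    ≡⟨ doubled-affine N (suc n) a b f u a*f≡u+b ⟩
  + 2 * evenBinomialSum N (suc n) (λ k → u (2 ℕ.* k)) + b * (+ 2 * evenBinomialSum N (suc n) (λ _ → + 1))
    ≡⟨ cong₂ (λ p q → p + b * q) (evenBinomialSum-even (subsequence-recurrence G-sum-product j (r + s)) (suc n))
                                 (evenBinomialSum-ones-even n) ⟩
  ((L (j + j) + + 2) ^ suc n + (L (j + j) - + 2) ^ suc n) * G (j * (+ N + (r + s))) + b * (+ 4) ^ suc n
    ≡⟨ cong₂ (λ p z → p * G (j * z) + b * (+ 4) ^ suc n) (even-powers j (suc n)) (sym (ℤ.+-assoc (+ N) r s)) ⟩
  (L j ^ N + (+ 5) ^ suc n * F j ^ N) * G (j * (+ N + r + s)) + b * (+ 4) ^ suc n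
    ∎
  where
  N = 2 ℕ.* suc n
  u = subsequence G j (r + s)

evenBinomialSum-subsequence-odd : ∀ {G : ℤ → ℤ} (D : ℤ → ℤ → ℤ) →
  (∀ y x → G (x + y) + sgn y * G (x - y) ≡ L y * G x) →
  (∀ y x → G (x + y) - sgn y * G (x - y) ≡ D y x) →
  ∀ j r s n a b (f : ℕ → ℤ) → (∀ k → a * f k ≡ subsequence G j (r + s) (2 ℕ.* k) + b) →
  + 2 * (a * evenBinomialSum (suc (2 ℕ.* n)) n f)
    ≡ sgn j * (L j ^ (2 ℕ.* n) * (L j * G (j * (+ suc (2 ℕ.* n) + r + s))))
      - sgn j * ((+ 5) ^ n * F j ^ (2 ℕ.* n) * D j (j * (+ suc (2 ℕ.* n) + r + s)))
      + b * (+ 2) ^ suc (2 ℕ.* n)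
evenBinomialSum-subsequence-odd {G} D G-sum-product G-difference-product j r s n a b f a*f≡u+b = begin
  + 2 * (a * evenBinomialSum N n f)
    ≡⟨ doubled-affine N n a b f u a*f≡u+b ⟩
  + 2 * evenBinomialSum N n (λ k → u (2 ℕ.* k)) + b * (+ 2 * evenBinomialSum N n (λ _ → + 1))
    ≡⟨ cong₂ (λ p q → p + b * q) (evenBinomialSum-odd (subsequence-recurrence G-sum-product j (r + s)) n)
                                 (evenBinomialSum-ones-odd n) ⟩
  (c + + 2) ^ n * (u n + u (suc n)) + (c - + 2) ^ n * (u n - u (suc n)) + b * (+ 2) ^ N
    ≡⟨ cong (_+ b * (+ 2) ^ N) (odd-powers j n (u n) (u (suc n))) ⟩
  ε * (P * (u (suc n) + ε * u n)) - ε * (Q * (u (suc n) - ε * u n)) + b * (+ 2) ^ N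
    ≡⟨ cong₂ (λ p q → ε * (P * p) - ε * (Q * q) + b * (+ 2) ^ N) sum difference ⟩
  ε * (P * (L j * G W)) - ε * (Q * D j W) + b * (+ 2) ^ N
    ∎
  where
  N = suc (2 ℕ.* n)
  u = subsequence G j (r + s)
  c = L (j + j)
  ε = sgn j
  P = L j ^ (2 ℕ.* n)
  Q = (+ 5) ^ n * F j ^ (2 ℕ.* n)
  W = j * (+ N + r + s)
  step₊ : ∀ j a r s → j * (a + + 2 + (r + s)) ≡ j * (+ 1 + a + r + s) + j
  step₊ = solve-∀
  step₋ : ∀ j a r s → j * (a + (r + s)) ≡ j * (+ 1 + a + r + s) - j
  step₋ = solve-∀
  above : j * (+ (2 ℕ.* suc n) + (r + s)) ≡ W + j
  above = trans (cong (λ z → j * (z + (r + s))) (+[2*suc] n)) (step₊ j (+ (2 ℕ.* n)) r s)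
  below : j * (+ (2 ℕ.* n) + (r + s)) ≡ W - j
  below = step₋ j (+ (2 ℕ.* n)) r s
  sum : u (suc n) + ε * u n ≡ L j * G W
  sum = trans (cong₂ (λ p q → G p + ε * G q) above below) (G-sum-product j W)
  difference : u (suc n) - ε * u n ≡ D j W
  difference = trans (cong₂ (λ p q → G p - ε * G q) above below) (G-difference-product j W)

product-reindex : ∀ (G : ℤ → ℤ) (_∙_ : ℤ → ℤ → ℤ) j r s k →
  let x = j * (+ (2 ℕ.* k) + r)
      y = j * (+ (2 ℕ.* k) + s)
  in G (x + y) ∙ (sgn y * G (x - y))
       ≡ subsequence G j (r + s) (2 ℕ.* k) ∙ (sgn (j * s) * G (j * (r - s)))
product-reindex G _∙_ j r s k =
  cong₂ _∙_ (cong G sum-index) (cong₂ (λ σ z → σ * G z) sgn-index (difference j (+ (2 ℕ.* k)) r s))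
  where
  collect : ∀ j a r s → j * (a + r) + j * (a + s) ≡ j * (+ 2 * a + (r + s))
  collect = solve-∀
  difference : ∀ j a r s → j * (a + r) - j * (a + s) ≡ j * (r - s)
  difference = solve-∀
  split : ∀ j a s → j * (+ 2 * a + s) ≡ (j * a + j * a) + j * s
  split = solve-∀

  sum-index : j * (+ (2 ℕ.* k) + r) + j * (+ (2 ℕ.* k) + s) ≡ j * (+ (2 ℕ.* (2 ℕ.* k)) + (r + s))
  sum-index = trans (collect j (+ (2 ℕ.* k)) r s) (cong (λ z → j * (z + (r + s))) (sym (ℤ.pos-* 2 (2 ℕ.* k))))

  sgn-index : sgn (j * (+ (2 ℕ.* k) + s)) ≡ sgn (j * s)
  sgn-index = begin
    sgn (j * (+ (2 ℕ.* k) + s))               ≡⟨ cong (λ z → sgn (j * (z + s))) (ℤ.pos-* 2 k) ⟩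
    sgn (j * (+ 2 * + k + s))                 ≡⟨ cong sgn (split j (+ k) s) ⟩
    sgn ((j * + k + j * + k) + j * s)         ≡⟨ sgn-+ (j * + k + j * + k) (j * s) ⟩
    sgn (j * + k + j * + k) * sgn (j * s)     ≡⟨ cong (_* sgn (j * s)) (sgn-double (j * + k)) ⟩
    + 1 * sgn (j * s)                         ≡⟨ ℤ.*-identityˡ (sgn (j * s)) ⟩
    sgn (j * s)                               ∎

F*F-linearised : ∀ j r s k →
  + 5 * (F (j * (+ (2 ℕ.* k) + r)) * F (j * (+ (2 ℕ.* k) + s)))
    ≡ subsequence L j (r + s) (2 ℕ.* k) - sgn (j * s) * L (j * (r - s))
F*F-linearised j r s k = begin
  + 5 * (F x * F y)                ≡⟨ swap (F x) (F y) ⟩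
  + 5 * F y * F x                  ≡⟨ L-difference-product y x ⟨
  L (x + y) - sgn y * L (x - y)    ≡⟨ product-reindex L _-_ j r s k ⟩
  subsequence L j (r + s) (2 ℕ.* k) - sgn (j * s) * L (j * (r - s)) ∎
  where
  x = j * (+ (2 ℕ.* k) + r)
  y = j * (+ (2 ℕ.* k) + s)
  swap : ∀ a b → + 5 * (a * b) ≡ + 5 * b * a
  swap = solve-∀

L*F-linearised : ∀ j r s k →
  + 1 * (L (j * (+ (2 ℕ.* k) + r)) * F (j * (+ (2 ℕ.* k) + s)))
    ≡ subsequence F j (r + s) (2 ℕ.* k) - sgn (j * s) * F (j * (r - s))
L*F-linearised j r s k = begin
  + 1 * (L x * F y)                ≡⟨ swap (L x) (F y) ⟩
  F y * L x                        ≡⟨ F-difference-product y x ⟨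
  F (x + y) - sgn y * F (x - y)    ≡⟨ product-reindex F _-_ j r s k ⟩
  subsequence F j (r + s) (2 ℕ.* k) - sgn (j * s) * F (j * (r - s)) ∎
  where
  x = j * (+ (2 ℕ.* k) + r)
  y = j * (+ (2 ℕ.* k) + s)
  swap : ∀ a b → + 1 * (a * b) ≡ b * a
  swap = solve-∀

L*L-linearised : ∀ j r s k →
  + 1 * (L (j * (+ (2 ℕ.* k) + r)) * L (j * (+ (2 ℕ.* k) + s)))
    ≡ subsequence L j (r + s) (2 ℕ.* k) + sgn (j * s) * L (j * (r - s))
L*L-linearised j r s k = begin
  + 1 * (L x * L y)                ≡⟨ swap (L x) (L y) ⟩
  L y * L x                        ≡⟨ L-sum-product y x ⟨
  L (x + y) + sgn y * L (x - y)    ≡⟨ product-reindex L _+_ j r s k ⟩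
  subsequence L j (r + s) (2 ℕ.* k) + sgn (j * s) * L (j * (r - s)) ∎
  where
  x = j * (+ (2 ℕ.* k) + r)
  y = j * (+ (2 ℕ.* k) + s)
  swap : ∀ a b → + 1 * (a * b) ≡ b * a
  swap = solve-∀

evenBinomialSum-FF[2n] : ∀ n r s j →
  + 10 * evenBinomialSum (2 ℕ.* suc n) (suc n) (λ k → F (j * (+ (2 ℕ.* k) + r)) * F (j * (+ (2 ℕ.* k) + s)))
    ≡ (L j ^ (2 ℕ.* suc n) + (+ 5) ^ suc n * F j ^ (2 ℕ.* suc n)) * L (j * (+ (2 ℕ.* suc n) + r + s))
      - sgn (j * s) * (+ 4) ^ suc n * L (j * (r - s))
evenBinomialSum-FF[2n] n r s j = begin
  + 10 * evenBinomialSum (2 ℕ.* suc n) (suc n) f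
    ≡⟨ ten≡2*5 (evenBinomialSum (2 ℕ.* suc n) (suc n) f) ⟩
  + 2 * (+ 5 * evenBinomialSum (2 ℕ.* suc n) (suc n) f)
    ≡⟨ evenBinomialSum-subsequence-even L-sum-product j r s n (+ 5) (- (σ * ℓ)) f (F*F-linearised j r s) ⟩
  A * L W + - (σ * ℓ) * (+ 4) ^ suc n
    ≡⟨ rearrange (A * L W) σ ℓ ((+ 4) ^ suc n) ⟩
  A * L W - σ * (+ 4) ^ suc n * ℓ
    ∎
  where
  f = λ k → F (j * (+ (2 ℕ.* k) + r)) * F (j * (+ (2 ℕ.* k) + s))
  A = L j ^ (2 ℕ.* suc n) + (+ 5) ^ suc n * F j ^ (2 ℕ.* suc n)
  W = j * (+ (2 ℕ.* suc n) + r + s)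
  σ = sgn (j * s)
  ℓ = L (j * (r - s))
  ten≡2*5 : ∀ x → + 10 * x ≡ + 2 * (+ 5 * x)
  ten≡2*5 = solve-∀
  rearrange : ∀ x σ ℓ q → x + - (σ * ℓ) * q ≡ x - σ * q * ℓ
  rearrange = solve-∀

evenBinomialSum-LF[2n] : ∀ n r s j →
  + 2 * evenBinomialSum (2 ℕ.* suc n) (suc n) (λ k → L (j * (+ (2 ℕ.* k) + r)) * F (j * (+ (2 ℕ.* k) + s)))
    ≡ (L j ^ (2 ℕ.* suc n) + (+ 5) ^ suc n * F j ^ (2 ℕ.* suc n)) * F (j * (+ (2 ℕ.* suc n) + r + s))
      - sgn (j * s) * (+ 4) ^ suc n * F (j * (r - s))
evenBinomialSum-LF[2n] n r s j = begin
  + 2 * evenBinomialSum (2 ℕ.* suc n) (suc n) f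
    ≡⟨ cong (+ 2 *_) (ℤ.*-identityˡ _) ⟨
  + 2 * (+ 1 * evenBinomialSum (2 ℕ.* suc n) (suc n) f)
    ≡⟨ evenBinomialSum-subsequence-even F-sum-product j r s n (+ 1) (- (σ * φ)) f (L*F-linearised j r s) ⟩
  A * F W + - (σ * φ) * (+ 4) ^ suc n
    ≡⟨ rearrange (A * F W) σ φ ((+ 4) ^ suc n) ⟩
  A * F W - σ * (+ 4) ^ suc n * φ
    ∎
  where
  f = λ k → L (j * (+ (2 ℕ.* k) + r)) * F (j * (+ (2 ℕ.* k) + s))
  A = L j ^ (2 ℕ.* suc n) + (+ 5) ^ suc n * F j ^ (2 ℕ.* suc n)
  W = j * (+ (2 ℕ.* suc n) + r + s)
  σ = sgn (j * s)
  φ = F (j * (r - s))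
  rearrange : ∀ x σ ℓ q → x + - (σ * ℓ) * q ≡ x - σ * q * ℓ
  rearrange = solve-∀

evenBinomialSum-LL[2n] : ∀ n r s j →
  + 2 * evenBinomialSum (2 ℕ.* suc n) (suc n) (λ k → L (j * (+ (2 ℕ.* k) + r)) * L (j * (+ (2 ℕ.* k) + s)))
    ≡ (L j ^ (2 ℕ.* suc n) + (+ 5) ^ suc n * F j ^ (2 ℕ.* suc n)) * L (j * (+ (2 ℕ.* suc n) + r + s))
      + sgn (j * s) * (+ 4) ^ suc n * L (j * (r - s))
evenBinomialSum-LL[2n] n r s j = begin
  + 2 * evenBinomialSum (2 ℕ.* suc n) (suc n) f
    ≡⟨ cong (+ 2 *_) (ℤ.*-identityˡ _) ⟨
  + 2 * (+ 1 * evenBinomialSum (2 ℕ.* suc n) (suc n) f)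
    ≡⟨ evenBinomialSum-subsequence-even L-sum-product j r s n (+ 1) (σ * ℓ) f (L*L-linearised j r s) ⟩
  A * L W + σ * ℓ * (+ 4) ^ suc n
    ≡⟨ rearrange (A * L W) σ ℓ ((+ 4) ^ suc n) ⟩
  A * L W + σ * (+ 4) ^ suc n * ℓ
    ∎
  where
  f = λ k → L (j * (+ (2 ℕ.* k) + r)) * L (j * (+ (2 ℕ.* k) + s))
  A = L j ^ (2 ℕ.* suc n) + (+ 5) ^ suc n * F j ^ (2 ℕ.* suc n)
  W = j * (+ (2 ℕ.* suc n) + r + s)
  σ = sgn (j * s)
  ℓ = L (j * (r - s))
  rearrange : ∀ x σ ℓ q → x + σ * ℓ * q ≡ x + σ * q * ℓ
  rearrange = solve-∀

evenBinomialSum-FF[2n+1] : ∀ n r s j {N} → N ≡ suc (2 ℕ.* n) →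
  + 10 * evenBinomialSum N n (λ k → F (j * (+ (2 ℕ.* k) + r)) * F (j * (+ (2 ℕ.* k) + s)))
    ≡ sgn j * L j ^ N * L (j * (+ N + r + s))
      - sgn j * (+ 5) ^ suc n * F j ^ N * F (j * (+ N + r + s))
      - sgn (j * s) * (+ 2) ^ N * L (j * (r - s))
evenBinomialSum-FF[2n+1] n r s j refl = begin
  + 10 * evenBinomialSum (suc (2 ℕ.* n)) n f
    ≡⟨ ten≡2*5 (evenBinomialSum (suc (2 ℕ.* n)) n f) ⟩
  + 2 * (+ 5 * evenBinomialSum (suc (2 ℕ.* n)) n f)
    ≡⟨ evenBinomialSum-subsequence-odd (λ y x → + 5 * F y * F x) L-sum-product L-difference-product
                                       j r s n (+ 5) (- (σ * ℓ)) f (F*F-linearised j r s) ⟩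
  ε * (L j ^ (2 ℕ.* n) * (L j * L W)) - ε * ((+ 5) ^ n * F j ^ (2 ℕ.* n) * (+ 5 * F j * F W))
    + - (σ * ℓ) * (+ 2) ^ suc (2 ℕ.* n)
    ≡⟨ rearrange ε (L j) (F j) (L j ^ (2 ℕ.* n)) ((+ 5) ^ n) (F j ^ (2 ℕ.* n)) (L W) (F W) σ ℓ ((+ 2) ^ suc (2 ℕ.* n)) ⟩
  ε * L j ^ suc (2 ℕ.* n) * L W - ε * (+ 5) ^ suc n * F j ^ suc (2 ℕ.* n) * F W
    - σ * (+ 2) ^ suc (2 ℕ.* n) * ℓ
    ∎
  where
  f = λ k → F (j * (+ (2 ℕ.* k) + r)) * F (j * (+ (2 ℕ.* k) + s))
  W = j * (+ suc (2 ℕ.* n) + r + s)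
  ε = sgn j
  σ = sgn (j * s)
  ℓ = L (j * (r - s))
  ten≡2*5 : ∀ x → + 10 * x ≡ + 2 * (+ 5 * x)
  ten≡2*5 = solve-∀
  rearrange : ∀ ε l φ p q φ′ lw fw σ ℓ t →
    ε * (p * (l * lw)) - ε * (q * φ′ * (+ 5 * φ * fw)) + - (σ * ℓ) * t
      ≡ ε * (l * p) * lw - ε * (+ 5 * q) * (φ * φ′) * fw - σ * t * ℓ
  rearrange = solve-∀

evenBinomialSum-LF[2n+1] : ∀ n r s j {N} → N ≡ suc (2 ℕ.* n) →
  + 2 * evenBinomialSum N n (λ k → L (j * (+ (2 ℕ.* k) + r)) * F (j * (+ (2 ℕ.* k) + s)))
    ≡ sgn j * L j ^ N * F (j * (+ N + r + s))
      - sgn j * (+ 5) ^ n * F j ^ N * L (j * (+ N + r + s))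
      - sgn (j * s) * (+ 2) ^ N * F (j * (r - s))
evenBinomialSum-LF[2n+1] n r s j refl = begin
  + 2 * evenBinomialSum (suc (2 ℕ.* n)) n f
    ≡⟨ cong (+ 2 *_) (ℤ.*-identityˡ _) ⟨
  + 2 * (+ 1 * evenBinomialSum (suc (2 ℕ.* n)) n f)
    ≡⟨ evenBinomialSum-subsequence-odd (λ y x → F y * L x) F-sum-product F-difference-product
                                       j r s n (+ 1) (- (σ * φ)) f (L*F-linearised j r s) ⟩
  ε * (L j ^ (2 ℕ.* n) * (L j * F W)) - ε * ((+ 5) ^ n * F j ^ (2 ℕ.* n) * (F j * L W))
    + - (σ * φ) * (+ 2) ^ suc (2 ℕ.* n)
    ≡⟨ rearrange ε (L j) (F j) (L j ^ (2 ℕ.* n)) ((+ 5) ^ n) (F j ^ (2 ℕ.* n)) (F W) (L W) σ φ ((+ 2) ^ suc (2 ℕ.* n)) ⟩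
  ε * L j ^ suc (2 ℕ.* n) * F W - ε * (+ 5) ^ n * F j ^ suc (2 ℕ.* n) * L W
    - σ * (+ 2) ^ suc (2 ℕ.* n) * φ
    ∎
  where
  f = λ k → L (j * (+ (2 ℕ.* k) + r)) * F (j * (+ (2 ℕ.* k) + s))
  W = j * (+ suc (2 ℕ.* n) + r + s)
  ε = sgn j
  σ = sgn (j * s)
  φ = F (j * (r - s))
  rearrange : ∀ ε l f p q f′ fw lw σ φ t →
    ε * (p * (l * fw)) - ε * (q * f′ * (f * lw)) + - (σ * φ) * t
      ≡ ε * (l * p) * fw - ε * q * (f * f′) * lw - σ * t * φ
  rearrange = solve-∀

evenBinomialSum-LL[2n+1] : ∀ n r s j {N} → N ≡ suc (2 ℕ.* n) →
  + 2 * evenBinomialSum N n (λ k → L (j * (+ (2 ℕ.* k) + r)) * L (j * (+ (2 ℕ.* k) + s)))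
    ≡ sgn j * L j ^ N * L (j * (+ N + r + s))
      - sgn j * (+ 5) ^ suc n * F j ^ N * F (j * (+ N + r + s))
      + sgn (j * s) * (+ 2) ^ N * L (j * (r - s))
evenBinomialSum-LL[2n+1] n r s j refl = begin
  + 2 * evenBinomialSum (suc (2 ℕ.* n)) n f
    ≡⟨ cong (+ 2 *_) (ℤ.*-identityˡ _) ⟨
  + 2 * (+ 1 * evenBinomialSum (suc (2 ℕ.* n)) n f)
    ≡⟨ evenBinomialSum-subsequence-odd (λ y x → + 5 * F y * F x) L-sum-product L-difference-product
                                       j r s n (+ 1) (σ * ℓ) f (L*L-linearised j r s) ⟩
  ε * (L j ^ (2 ℕ.* n) * (L j * L W)) - ε * ((+ 5) ^ n * F j ^ (2 ℕ.* n) * (+ 5 * F j * F W))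
    + σ * ℓ * (+ 2) ^ suc (2 ℕ.* n)
    ≡⟨ rearrange ε (L j) (F j) (L j ^ (2 ℕ.* n)) ((+ 5) ^ n) (F j ^ (2 ℕ.* n)) (L W) (F W) σ ℓ ((+ 2) ^ suc (2 ℕ.* n)) ⟩
  ε * L j ^ suc (2 ℕ.* n) * L W - ε * (+ 5) ^ suc n * F j ^ suc (2 ℕ.* n) * F W
    + σ * (+ 2) ^ suc (2 ℕ.* n) * ℓ
    ∎
  where
  f = λ k → L (j * (+ (2 ℕ.* k) + r)) * L (j * (+ (2 ℕ.* k) + s))
  W = j * (+ suc (2 ℕ.* n) + r + s)
  ε = sgn j
  σ = sgn (j * s)
  ℓ = L (j * (r - s))
  rearrange : ∀ ε l f p q f′ lw fw σ ℓ t →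
    ε * (p * (l * lw)) - ε * (q * f′ * (+ 5 * f * fw)) + σ * ℓ * t
      ≡ ε * (l * p) * lw - ε * (+ 5 * q) * (f * f′) * fw + σ * t * ℓ
  rearrange = solve-∀

2[1+n]∸1≡1+2n : ∀ n → 2 ℕ.* suc n ℕ.∸ 1 ≡ suc (2 ℕ.* n)
2[1+n]∸1≡1+2n n = cong (ℕ._∸ 1) (ℕ.*-suc 2 n)

theorem27 : (n : ℕ) → 1 ℕ.≤ n → (r s j : ℤ) →
  let m = + (2 ℕ.* n)
      m1 = + (2 ℕ.* n ℕ.∸ 1)
      A = (L j ^ (2 ℕ.* n)) + ((+ 5) ^ n) * (F j ^ (2 ℕ.* n))
      σ = sgn (j * s)
  in ((+ 10) * sumTo n (λ k → binom (2 ℕ.* n) (2 ℕ.* k) * (F (j * (+ (2 ℕ.* k) + r)) * F (j * (+ (2 ℕ.* k) + s))))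
        ≡ A * L (j * (m + r + s)) - σ * ((+ 4) ^ n) * L (j * (r - s)))
  × ((+ 2) * sumTo n (λ k → binom (2 ℕ.* n) (2 ℕ.* k) * (L (j * (+ (2 ℕ.* k) + r)) * F (j * (+ (2 ℕ.* k) + s))))
        ≡ A * F (j * (m + r + s)) - σ * ((+ 4) ^ n) * F (j * (r - s)))
  × ((+ 2) * sumTo n (λ k → binom (2 ℕ.* n) (2 ℕ.* k) * (L (j * (+ (2 ℕ.* k) + r)) * L (j * (+ (2 ℕ.* k) + s))))
        ≡ A * L (j * (m + r + s)) + σ * ((+ 4) ^ n) * L (j * (r - s)))
  × ((+ 10) * sumTo (n ℕ.∸ 1) (λ k → binom (2 ℕ.* n ℕ.∸ 1) (2 ℕ.* k) * (F (j * (+ (2 ℕ.* k) + r)) * F (j * (+ (2 ℕ.* k) + s))))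
        ≡ sgn j * (L j ^ (2 ℕ.* n ℕ.∸ 1)) * L (j * (m1 + r + s))
          - sgn j * ((+ 5) ^ n) * (F j ^ (2 ℕ.* n ℕ.∸ 1)) * F (j * (m1 + r + s))
          - σ * ((+ 2) ^ (2 ℕ.* n ℕ.∸ 1)) * L (j * (r - s)))
  × ((+ 2) * sumTo (n ℕ.∸ 1) (λ k → binom (2 ℕ.* n ℕ.∸ 1) (2 ℕ.* k) * (L (j * (+ (2 ℕ.* k) + r)) * F (j * (+ (2 ℕ.* k) + s))))
        ≡ sgn j * (L j ^ (2 ℕ.* n ℕ.∸ 1)) * F (j * (m1 + r + s))
          - sgn j * ((+ 5) ^ (n ℕ.∸ 1)) * (F j ^ (2 ℕ.* n ℕ.∸ 1)) * L (j * (m1 + r + s))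
          - σ * ((+ 2) ^ (2 ℕ.* n ℕ.∸ 1)) * F (j * (r - s)))
  × ((+ 2) * sumTo (n ℕ.∸ 1) (λ k → binom (2 ℕ.* n ℕ.∸ 1) (2 ℕ.* k) * (L (j * (+ (2 ℕ.* k) + r)) * L (j * (+ (2 ℕ.* k) + s))))
        ≡ sgn j * (L j ^ (2 ℕ.* n ℕ.∸ 1)) * L (j * (m1 + r + s))
          - sgn j * ((+ 5) ^ n) * (F j ^ (2 ℕ.* n ℕ.∸ 1)) * F (j * (m1 + r + s))
          + σ * ((+ 2) ^ (2 ℕ.* n ℕ.∸ 1)) * L (j * (r - s)))
theorem27 (suc n) _ r s j =
  evenBinomialSum-FF[2n] n r s j , evenBinomialSum-LF[2n] n r s j , evenBinomialSum-LL[2n] n r s j ,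
  evenBinomialSum-FF[2n+1] n r s j N≡1+2n , evenBinomialSum-LF[2n+1] n r s j N≡1+2n , evenBinomialSum-LL[2n+1] n r s j N≡1+2n
  where
  N≡1+2n = 2[1+n]∸1≡1+2n n
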